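{- Let $r\ge 3$ and let $\mathcal{H}$ be an $r$-uniform $r$-partite linear hypergraph which contains no rainbow cycles of length three or four. Then $\mathcal{H}$ is $\mathcal{G}_r(7r-11,7)$-free.
   Context: A hypergraph is linear if any two distinct edges share at most one vertex. An $r$-uniform hypergraph is $r$-partite if its vertex set is partitioned into $r$ parts $V_1,\dots,V_r$ such that every edge contains exactly one vertex of each part. A cycle of length $k$ is a sequence $v_1,A_1,\dots,v_k,A_k,v_1$ of distinct vertices and distinct edges with $v_i,v_{i+1}\in A_i$ ($1\le i\le k-1$) and $v_k,v_1\in A_k$; it is a rainbow $k$-cycle if $v_1,\dots,v_k$ lie in pairwise different parts. An $r$-uniform hypergraph is $\mathcal{G}_r(v,e)$-free if the union of any $e$ distinct edges has at least $v+1$ vertices. -}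

module Defs where

open import Data.Nat using (ℕ; zero; suc; _+_; _*_; _∸_; _≤_)
open import Data.Nat.DivMod using (_%_; m%n<n)
open import Data.Fin using (Fin; toℕ; fromℕ<)
open import Data.Fin.Properties using (any?; _≟_)
open import Data.Fin.Subset using (Subset; ∣_∣)
open import Data.Vec using (tabulate)
open import Data.Product using (Σ; ∃; _×_; _,_)
open import Relation.Binary.PropositionalEquality using (_≡_; _≢_)
open import Relation.Nullary.Decidable using (⌊_⌋)
open import Data.Empty using (⊥)
open import Function.Definitions using (Injective)

-- Each edge a is given by the function i ↦ (its vertex in part i),
-- so every edge contains exactly one vertex of each part.
record PartiteHypergraph (r n m : ℕ) : Set where
  field
    part     : Fin n → Fin r
    edge     : Fin m → Fin r → Fin n
    edge-part : ∀ a i → part (edge a i) ≡ i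
    edges-distinct : ∀ a b → a ≢ b → Σ (Fin r) λ i → edge a i ≢ edge b i

  _∈ₑ_ : Fin n → Fin m → Set
  v ∈ₑ a = Σ (Fin r) λ i → edge a i ≡ v

open PartiteHypergraph public

Linear : ∀ {r n m} → PartiteHypergraph r n m → Set
Linear H = ∀ a b u v → a ≢ b →
  _∈ₑ_ H u a → _∈ₑ_ H u b → _∈ₑ_ H v a → _∈ₑ_ H v b → u ≡ v

next : ∀ {k} → Fin (suc k) → Fin (suc k)
next {k} i = fromℕ< (m%n<n (suc (toℕ i)) (suc k))

RainbowCycle : ∀ {r n m} → PartiteHypergraph r n m → ℕ → Set
RainbowCycle H zero = ⊥
RainbowCycle {r} {n} {m} H (suc k) =
  Σ (Fin (suc k) → Fin n) λ v →
  Σ (Fin (suc k) → Fin m) λ A →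
    Injective _≡_ _≡_ v ×
    Injective _≡_ _≡_ A ×
    Injective _≡_ _≡_ (λ i → part H (v i)) ×
    (∀ i → _∈ₑ_ H (v i) (A i)) ×
    (∀ i → _∈ₑ_ H (v (next i)) (A i))

edgeUnion : ∀ {r n m e} → PartiteHypergraph r n m → (Fin e → Fin m) → Subset n
edgeUnion H S = tabulate λ x → ⌊ any? (λ j → any? (λ i → edge H (S j) i ≟ x)) ⌋

GFree : ∀ {r n m} → PartiteHypergraph r n m → ℕ → ℕ → Set
GFree {r} {n} {m} H v e =
  (S : Fin e → Fin m) → Injective _≡_ _≡_ S → suc v ≤ ∣ edgeUnion H S ∣

module Submission where

-- List the seven edges as S 0, …, S 6.  Each has r vertices, and a vertex of
-- S j is missing from the count of the union only when it reappears in a later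
-- edge, so 7r ≤ |⋃ S| + Σⱼ repeats j (EdgeUnion.union-bound).  A repeated
-- vertex of S j in part p gives an arc from j to the last edge through that
-- vertex, and by linearity distinct parts give distinct arcs.  The resulting
-- merge graph on the seven edges has no triangle (no rainbow C₃) and no K₂,₄
-- (no rainbow C₃ or C₄), and such a graph on 7 vertices has at most 10 edges
-- (degree-sum≤21).  Hence Σⱼ repeats j ≤ 10 and |⋃ S| ≥ 7r - 10.

open import Defs
open import Data.Nat using (ℕ; zero; suc; _+_; _*_; _∸_; _≤_; z≤n; s≤s; _≤?_)
open import Data.Nat.Properties
  using (+-*-semiring; ≤-refl; ≤-reflexive; ≤-antisym; ≤-trans; <-≤-trans; ≤-pred; ≰⇒>; 1+n≰n;
         +-mono-≤; +-monoˡ-≤; +-monoʳ-≤; *-monoʳ-≤; +-cancelʳ-≤; m≤m+n; m≤n+m; n≤1+n; m∸n≤m;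
         m+n≤o⇒m≤o∸n; m∸n+n≡m; +-identityʳ; *-zeroʳ; *-identityʳ; +-assoc; +-suc; *-distribˡ-+;
         module ≤-Reasoning)
import Data.Fin as Fin
import Data.Fin.Properties as FinP
open import Data.Fin using (Fin; zero; suc; inject≤)
open import Data.Fin.Patterns using (0F; 1F; 2F; 3F)
open import Data.Fin.Properties using (_≟_; any?; all?; ¬∀⟶∃¬; suc-injective; inject≤-injective)
open import Data.Fin.Subset using (∣_∣)
open import Data.Vec using ([]; _∷_; tabulate; lookup)
open import Data.Vec.Relation.Unary.AllPairs using ([]; _∷_)
open import Data.Vec.Relation.Unary.All using ([]; _∷_)
open import Data.Vec.Relation.Unary.Unique.Propositional.Properties using (lookup-injective)
open import Data.Bool using (if_then_else_)
open import Data.Product using (Σ; ∃; _×_; _,_; proj₁; proj₂)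
open import Data.Sum using (_⊎_; inj₁; inj₂)
open import Data.Empty using (⊥; ⊥-elim)
open import Function.Definitions using (Injective)
open import Relation.Nullary using (¬_; Dec; yes; no; does)
open import Relation.Nullary.Decidable using (_×-dec_; _⊎-dec_; _→-dec_; ¬?; ⌊_⌋)
open import Relation.Binary.PropositionalEquality
open import Data.Nat.Tactic.RingSolver using (solve-∀)
open import Algebra.Properties.Semiring.Sum +-*-semiring
  using (sum; sum-syntax; ∑-comm; ∑-distrib-+; sum-cong-≗; *-distribˡ-sum)

module Counting where

  𝟙 : ∀ {P : Set} → Dec P → ℕ
  𝟙 d = if does d then 1 else 0

  count : ∀ {n} {P : Fin n → Set} → (∀ x → Dec (P x)) → ℕ
  count P? = ∑[ x < _ ] 𝟙 (P? x)

  𝟙-yes : ∀ {P : Set} (d : Dec P) → P → 𝟙 d ≡ 1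
  𝟙-yes (yes _) _ = refl
  𝟙-yes (no ¬p) p = ⊥-elim (¬p p)

  𝟙-no : ∀ {P : Set} (d : Dec P) → ¬ P → 𝟙 d ≡ 0
  𝟙-no (yes p) ¬p = ⊥-elim (¬p p)
  𝟙-no (no _) _ = refl

  𝟙-mono : ∀ {P Q : Set} (p : Dec P) (q : Dec Q) → (P → Q) → 𝟙 p ≤ 𝟙 q
  𝟙-mono (yes x) q f = ≤-reflexive (sym (𝟙-yes q (f x)))
  𝟙-mono (no _) q f = z≤n

  𝟙-disjoint : ∀ {P Q R : Set} (p : Dec P) (q : Dec Q) (r : Dec R) →
               (P → R) → (Q → R) → (P → Q → ⊥) → 𝟙 p + 𝟙 q ≤ 𝟙 r
  𝟙-disjoint (no _) q r _ g _ = 𝟙-mono q r g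
  𝟙-disjoint (yes x) q r f _ h rewrite 𝟙-no q (h x) | 𝟙-yes r (f x) = ≤-refl

  𝟙-cong : ∀ {P Q : Set} (p : Dec P) (q : Dec Q) → (P → Q) → (Q → P) → 𝟙 p ≡ 𝟙 q
  𝟙-cong p q f g = ≤-antisym (𝟙-mono p q f) (𝟙-mono q p g)

  𝟙-split : ∀ {P Q R : Set} (p : Dec P) (q : Dec Q) (r : Dec R) → (P → Q ⊎ R) → 𝟙 p ≤ 𝟙 q + 𝟙 r
  𝟙-split (no _) q r _ = z≤n
  𝟙-split (yes x) q r f with f x
  ... | inj₁ y = ≤-trans (𝟙-mono (yes x) q (λ _ → y)) (m≤m+n _ _)
  ... | inj₂ z = ≤-trans (𝟙-mono (yes x) r (λ _ → z)) (m≤n+m _ _)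

  𝟙-× : ∀ {P Q : Set} (p : Dec P) (q : Dec Q) → 𝟙 (p ×-dec q) ≡ 𝟙 p * 𝟙 q
  𝟙-× (yes _) (yes _) = refl
  𝟙-× (yes _) (no _) = refl
  𝟙-× (no _) _ = refl

  ∑-mono : ∀ {n} {f g : Fin n → ℕ} → (∀ x → f x ≤ g x) → sum f ≤ sum g
  ∑-mono {zero} h = z≤n
  ∑-mono {suc n} h = +-mono-≤ (h zero) (∑-mono (λ x → h (suc x)))

  ∑-const : ∀ n (c : ℕ) → ∑[ x < n ] c ≡ n * c
  ∑-const zero c = refl
  ∑-const (suc n) c = cong (c +_) (∑-const n c)

  ∑-bounded : ∀ {n} (f : Fin n → ℕ) c → (∀ x → f x ≤ c) → sum f ≤ n * c
  ∑-bounded {n} f c h = ≤-trans (∑-mono h) (≤-reflexive (∑-const n c))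

  term≤∑ : ∀ {n} (f : Fin n → ℕ) (a : Fin n) → f a ≤ sum f
  term≤∑ f zero = m≤m+n _ _
  term≤∑ f (suc a) = ≤-trans (term≤∑ (λ x → f (suc x)) a) (m≤n+m _ _)

  record Enumeration {n} (P : Fin n → Set) (k : ℕ) : Set where
    field
      elem : Fin k → Fin n
      elem-injective : Injective _≡_ _≡_ elem
      elem-sound : ∀ i → P (elem i)
      elem-complete : ∀ x → P x → ∃ λ i → elem i ≡ x

  enumerate : ∀ {n} {P : Fin n → Set} (P? : ∀ x → Dec (P x)) → Enumeration P (count P?)
  enumerate {zero} P? = record
    { elem = λ () ; elem-injective = λ {} ; elem-sound = λ () ; elem-complete = λ () }
  enumerate {suc n} P? with P? zero | enumerate (λ x → P? (suc x))
  ... | yes p0 | rest = record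
    { elem = listing
    ; elem-injective = injective
    ; elem-sound = λ { zero → p0 ; (suc i) → elem-sound i }
    ; elem-complete = λ { zero _ → zero , refl
                        ; (suc x) p → let i , e = elem-complete x p in suc i , cong suc e } }
    where
    open Enumeration rest
    listing : Fin (suc (count (λ x → P? (suc x)))) → Fin (suc n)
    listing zero = zero
    listing (suc i) = suc (elem i)
    injective : Injective _≡_ _≡_ listing
    injective {zero} {zero} _ = refl
    injective {zero} {suc _} ()
    injective {suc _} {zero} ()
    injective {suc i} {suc j} e = cong suc (elem-injective (suc-injective e))
  ... | no ¬p0 | rest = record
    { elem = λ i → suc (elem i)
    ; elem-injective = λ e → elem-injective (suc-injective e)
    ; elem-sound = elem-sound
    ; elem-complete = λ { zero p → ⊥-elim (¬p0 p)
                        ; (suc x) p → let i , e = elem-complete x p in i , cong suc e } }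
    where open Enumeration rest

  ∑-single : ∀ {n} (f : Fin n → ℕ) (a : Fin n) → (∀ x → x ≢ a → f x ≡ 0) → sum f ≡ f a
  ∑-single {suc n} f zero h = begin
    f zero + ∑[ x < n ] f (suc x)  ≡⟨ cong (f zero +_) (sum-cong-≗ (λ x → h (suc x) λ ())) ⟩
    f zero + ∑[ x < n ] 0          ≡⟨ cong (f zero +_) (trans (∑-const n 0) (*-zeroʳ n)) ⟩
    f zero + 0                     ≡⟨ +-identityʳ (f zero) ⟩
    f zero                         ∎
    where open ≡-Reasoning
  ∑-single {suc n} f (suc a) h = begin
    f zero + ∑[ x < n ] f (suc x)  ≡⟨ cong (_+ ∑[ x < n ] f (suc x)) (h zero λ ()) ⟩
    ∑[ x < n ] f (suc x)
      ≡⟨ ∑-single (λ x → f (suc x)) a (λ x x≢a → h (suc x) (λ e → x≢a (suc-injective e))) ⟩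
    f (suc a)                      ∎
    where open ≡-Reasoning

  ∑-select : ∀ {n} (g : Fin n → ℕ) (a : Fin n) → ∑[ x < n ] (𝟙 (a ≟ x) * g x) ≡ g a
  ∑-select g a = trans (∑-single _ a (λ x x≢a → cong (_* g x) (𝟙-no (a ≟ x) (λ e → x≢a (sym e)))))
                       (trans (cong (_* g a) (𝟙-yes (a ≟ a) refl)) (+-identityʳ (g a)))

  count-single : ∀ {n} (a : Fin n) → count (a ≟_) ≡ 1
  count-single a = trans (sum-cong-≗ (λ x → sym (*-identityʳ (𝟙 (a ≟ x))))) (∑-select (λ _ → 1) a)

  ∑-cover : ∀ {n k} {P : Fin n → Set} (P? : ∀ x → Dec (P x)) (g : Fin n → ℕ) (f : Fin k → Fin n) →
            (∀ x → P x → ∃ λ i → f i ≡ x) → ∑[ x < n ] (𝟙 (P? x) * g x) ≤ ∑[ i < k ] g (f i)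
  ∑-cover {n} {k} P? g f covered = begin
    ∑[ x < n ] (𝟙 (P? x) * g x)                ≤⟨ ∑-mono pointwise ⟩
    ∑[ x < n ] ∑[ i < k ] (𝟙 (f i ≟ x) * g x)  ≡⟨ ∑-comm (λ x i → 𝟙 (f i ≟ x) * g x) ⟩
    ∑[ i < k ] ∑[ x < n ] (𝟙 (f i ≟ x) * g x)  ≡⟨ sum-cong-≗ (λ i → ∑-select g (f i)) ⟩
    ∑[ i < k ] g (f i)                         ∎
    where
    open ≤-Reasoning
    pointwise : ∀ x → 𝟙 (P? x) * g x ≤ ∑[ i < k ] (𝟙 (f i ≟ x) * g x)
    pointwise x with P? x
    ... | no _ = z≤n
    ... | yes p with covered x p
    ...   | i , fi≡x = begin
      1 * g x                 ≡⟨ cong (_* g x) (𝟙-yes (f i ≟ x) fi≡x) ⟨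
      𝟙 (f i ≟ x) * g x       ≤⟨ term≤∑ (λ j → 𝟙 (f j ≟ x) * g x) i ⟩
      ∑[ j < k ] (𝟙 (f j ≟ x) * g x) ∎

  count≤1 : ∀ {n} {P : Fin n → Set} (P? : ∀ x → Dec (P x)) →
            (∀ x y → P x → P y → x ≡ y) → count P? ≤ 1
  count≤1 P? unique with count P? | enumerate P?
  ... | zero | _ = z≤n
  ... | suc zero | _ = ≤-refl
  ... | suc (suc _) | E with elem-injective (unique _ _ (elem-sound zero) (elem-sound (suc zero)))
    where open Enumeration E
  ...   | ()

  count-injection : ∀ {k l} {P : Fin k → Set} {Q : Fin l → Set} {R : Fin k → Fin l → Set}
    (P? : ∀ x → Dec (P x)) (Q? : ∀ y → Dec (Q y)) (R? : ∀ x y → Dec (R x y)) →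
    (∀ x → P x → ∃ λ y → R x y) → (∀ x y → R x y → Q y) → (∀ x x' y → R x y → R x' y → x ≡ x') →
    count P? ≤ count Q?
  count-injection {k} {l} P? Q? R? partner toQ unique = begin
    ∑[ x < k ] 𝟙 (P? x)                ≤⟨ ∑-mono some-partner ⟩
    ∑[ x < k ] ∑[ y < l ] 𝟙 (R? x y)   ≡⟨ ∑-comm (λ x y → 𝟙 (R? x y)) ⟩
    ∑[ y < l ] ∑[ x < k ] 𝟙 (R? x y)   ≤⟨ ∑-mono one-preimage ⟩
    ∑[ y < l ] 𝟙 (Q? y)                ∎
    where
    open ≤-Reasoning
    some-partner : ∀ x → 𝟙 (P? x) ≤ ∑[ y < l ] 𝟙 (R? x y)
    some-partner x with P? x
    ... | no _ = z≤n
    ... | yes p with partner x p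
    ...   | y , r = ≤-trans (≤-reflexive (sym (𝟙-yes (R? x y) r))) (term≤∑ (λ z → 𝟙 (R? x z)) y)
    one-preimage : ∀ y → ∑[ x < k ] 𝟙 (R? x y) ≤ 𝟙 (Q? y)
    one-preimage y with Q? y
    ... | yes _ = count≤1 (λ x → R? x y) (λ x x' r r' → unique x x' y r r')
    ... | no ¬q = ≤-reflexive (trans (sum-cong-≗ (λ x → 𝟙-no (R? x y) (λ r → ¬q (toQ x y r))))
                                     (trans (∑-const k 0) (*-zeroʳ k)))

  ∣tabulate∣ : ∀ {n} {P : Fin n → Set} (P? : ∀ x → Dec (P x)) →
               ∣ tabulate (λ x → ⌊ P? x ⌋) ∣ ≡ count P?
  ∣tabulate∣ {zero} P? = refl
  ∣tabulate∣ {suc _} P? with P? zero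
  ... | yes _ = cong suc (∣tabulate∣ (λ x → P? (suc x)))
  ... | no _ = ∣tabulate∣ (λ x → P? (suc x))

  largest : ∀ {n} {Q : Fin n → Set} (Q? : ∀ x → Dec (Q x)) → ∃ Q →
            ∃ λ M → Q M × (∀ z → Q z → z Fin.≤ M)
  largest {suc _} Q? (w , qw) with any? (λ x → Q? (suc x))
  ... | yes later with largest (λ x → Q? (suc x)) later
  ...   | M , qM , top = suc M , qM , λ { zero _ → z≤n ; (suc z) qz → s≤s (top z qz) }
  largest {suc _} Q? (zero , q0) | no ¬later =
    zero , q0 , λ { zero _ → z≤n ; (suc z) qz → ⊥-elim (¬later (z , qz)) }
  largest {suc _} Q? (suc w , qw) | no ¬later = ⊥-elim (¬later (w , qw))

open Counting

record TriangleK24FreeGraph (N : ℕ) : Set₁ where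
  field
    Adj : Fin N → Fin N → Set
    adj? : ∀ x y → Dec (Adj x y)
    adj-sym : ∀ {x y} → Adj x y → Adj y x
    adj-irrefl : ∀ {x} → ¬ Adj x x
    triangle-free : ∀ {x y z} → Adj x y → Adj y z → Adj x z → ⊥
    K24-free : ∀ {u w} (f : Fin 4 → Fin N) → u ≢ w → Injective _≡_ _≡_ f →
               (∀ i → Adj u (f i)) → (∀ i → Adj w (f i)) → ⊥

module GraphDegrees {N} (G : TriangleK24FreeGraph N) where
  open TriangleK24FreeGraph G

  deg : Fin N → ℕ
  deg v = count (adj? v)

  codeg : Fin N → Fin N → ℕ
  codeg u w = count (λ x → adj? u x ×-dec adj? w x)

  -- Four common neighbours of two vertices would form a K₂,₄.
  codeg≤3 : ∀ {u w} → u ≢ w → codeg u w ≤ 3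
  codeg≤3 {u} {w} u≢w with 4 ≤? codeg u w
  ... | no c≱4 = ≤-pred (≰⇒> c≱4)
  ... | yes 4≤c = ⊥-elim (K24-free four u≢w four-injective (λ i → proj₁ (elem-sound _)) (λ i → proj₂ (elem-sound _)))
    where
    open Enumeration (enumerate (λ x → adj? u x ×-dec adj? w x))
    four : Fin 4 → Fin N
    four i = elem (inject≤ i 4≤c)
    four-injective : Injective _≡_ _≡_ four
    four-injective e = inject≤-injective _ _ _ _ (elem-injective e)

  -- Adjacent vertices have no common neighbour, so their common
  -- neighbourhoods with any u are disjoint parts of the neighbourhood of u.
  codeg-adjacent : ∀ u {w₁ w₂} → Adj w₁ w₂ → codeg u w₁ + codeg u w₂ ≤ deg u
  codeg-adjacent u {w₁} {w₂} w₁w₂ = begin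
    codeg u w₁ + codeg u w₂  ≡⟨ ∑-distrib-+ (λ x → 𝟙 (adj? u x ×-dec adj? w₁ x)) _ ⟨
    ∑[ x < N ] (𝟙 (adj? u x ×-dec adj? w₁ x) + 𝟙 (adj? u x ×-dec adj? w₂ x))
      ≤⟨ ∑-mono (λ x → 𝟙-disjoint (adj? u x ×-dec adj? w₁ x) (adj? u x ×-dec adj? w₂ x) (adj? u x)
                        proj₁ proj₁ (λ (_ , w₁x) (_ , w₂x) → triangle-free w₁w₂ w₂x w₁x)) ⟩
    deg u                    ∎
    where open ≤-Reasoning

  module Around (u : Fin N) where
    W : Fin N → Set
    W x = x ≢ u × ¬ Adj u x

    W? : ∀ x → Dec (W x)
    W? x = ¬? (x ≟ u) ×-dec ¬? (adj? u x)

    degW : Fin N → ℕ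
    degW v = count (λ x → W? x ×-dec adj? v x)

    weight : Fin N → ℕ
    weight w = codeg u w + deg w

    Φ : ℕ
    Φ = ∑[ w < N ] (𝟙 (W? w) * weight w)

    partition : 1 + deg u + count W? ≤ N
    partition = begin
      1 + deg u + count W?                                ≡⟨ cong (λ c → c + deg u + count W?) (count-single u) ⟨
      count (u ≟_) + deg u + count W?
        ≡⟨ trans (∑-distrib-+ (λ x → 𝟙 (u ≟ x) + 𝟙 (adj? u x)) (λ x → 𝟙 (W? x)))
                 (cong (_+ count W?) (∑-distrib-+ (λ x → 𝟙 (u ≟ x)) (λ x → 𝟙 (adj? u x)))) ⟨
      ∑[ x < N ] (𝟙 (u ≟ x) + 𝟙 (adj? u x) + 𝟙 (W? x))    ≤⟨ ∑-bounded _ 1 one-class ⟩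
      N * 1                                               ≡⟨ *-identityʳ N ⟩
      N                                                   ∎
      where
      open ≤-Reasoning
      one-class : ∀ x → 𝟙 (u ≟ x) + 𝟙 (adj? u x) + 𝟙 (W? x) ≤ 1
      one-class x with u ≟ x | x ≟ u | adj? u x
      ... | yes refl | _        | yes uu = ⊥-elim (adj-irrefl uu)
      ... | yes refl | yes _    | no _   = ≤-refl
      ... | yes refl | no u≢u   | _      = ⊥-elim (u≢u refl)
      ... | no u≢x   | yes x≡u  | _      = ⊥-elim (u≢x (sym x≡u))
      ... | no _     | no _     | yes _  = ≤-refl
      ... | no _     | no _     | no _   = ≤-refl

    -- A neighbour of u has, apart from u, only neighbours in W (no triangles).
    neighbour-degree : ∀ {v} → Adj u v → deg v ≤ 1 + degW v
    neighbour-degree {v} uv = begin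
      deg v                                                 ≤⟨ ∑-mono pointwise ⟩
      ∑[ x < N ] (𝟙 (u ≟ x) + 𝟙 (W? x ×-dec adj? v x))      ≡⟨ ∑-distrib-+ (λ x → 𝟙 (u ≟ x)) _ ⟩
      count (u ≟_) + degW v                                 ≡⟨ cong (_+ degW v) (count-single u) ⟩
      1 + degW v                                            ∎
      where
      open ≤-Reasoning
      pointwise : ∀ x → 𝟙 (adj? v x) ≤ 𝟙 (u ≟ x) + 𝟙 (W? x ×-dec adj? v x)
      pointwise x = 𝟙-split (adj? v x) (u ≟ x) (W? x ×-dec adj? v x) split
        where
        split : Adj v x → u ≡ x ⊎ (W x × Adj v x)
        split vx with u ≟ x
        ... | yes u≡x = inj₁ u≡x
        ... | no u≢x = inj₂ (((λ x≡u → u≢x (sym x≡u)) , λ ux → triangle-free uv vx ux) , vx)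

    -- A vertex of W has neighbours only among the neighbours of u and in W.
    nonneighbour-degree : ∀ {w} → W w → deg w ≤ codeg u w + degW w
    nonneighbour-degree {w} (_ , ¬uw) = begin
      deg w                                                               ≤⟨ ∑-mono pointwise ⟩
      ∑[ x < N ] (𝟙 (adj? u x ×-dec adj? w x) + 𝟙 (W? x ×-dec adj? w x))
        ≡⟨ ∑-distrib-+ (λ x → 𝟙 (adj? u x ×-dec adj? w x)) _ ⟩
      codeg u w + degW w                                                  ∎
      where
      open ≤-Reasoning
      pointwise : ∀ x → 𝟙 (adj? w x) ≤ 𝟙 (adj? u x ×-dec adj? w x) + 𝟙 (W? x ×-dec adj? w x)
      pointwise x = 𝟙-split (adj? w x) (adj? u x ×-dec adj? w x) (W? x ×-dec adj? w x) split
        where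
        split : Adj w x → (Adj u x × Adj w x) ⊎ (W x × Adj w x)
        split wx with adj? u x
        ... | yes ux = inj₁ (ux , wx)
        ... | no ¬ux = inj₂ (((λ { refl → ¬uw (adj-sym wx) }) , ¬ux) , wx)

    -- Double counting the paths u – v – w with w ∈ W.
    neighbour-degree-sum : ∑[ v < N ] (𝟙 (adj? u v) * degW v) ≤ ∑[ w < N ] (𝟙 (W? w) * codeg u w)
    neighbour-degree-sum = begin
      ∑[ v < N ] (𝟙 (adj? u v) * degW v)
        ≡⟨ sum-cong-≗ (λ v → *-distribˡ-sum (𝟙 (adj? u v)) (λ w → 𝟙 (W? w ×-dec adj? v w))) ⟩
      ∑[ v < N ] ∑[ w < N ] (𝟙 (adj? u v) * 𝟙 (W? w ×-dec adj? v w))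
        ≡⟨ ∑-comm (λ v w → 𝟙 (adj? u v) * 𝟙 (W? w ×-dec adj? v w)) ⟩
      ∑[ w < N ] ∑[ v < N ] (𝟙 (adj? u v) * 𝟙 (W? w ×-dec adj? v w))
        ≤⟨ ∑-mono (λ w → ∑-mono (λ v → path w v)) ⟩
      ∑[ w < N ] ∑[ v < N ] (𝟙 (W? w) * 𝟙 (adj? u v ×-dec adj? w v))
        ≡⟨ sum-cong-≗ (λ w → *-distribˡ-sum (𝟙 (W? w)) (λ v → 𝟙 (adj? u v ×-dec adj? w v))) ⟨
      ∑[ w < N ] (𝟙 (W? w) * codeg u w)          ∎
      where
      open ≤-Reasoning
      path : ∀ w v → 𝟙 (adj? u v) * 𝟙 (W? w ×-dec adj? v w) ≤ 𝟙 (W? w) * 𝟙 (adj? u v ×-dec adj? w v)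
      path w v = begin
        𝟙 (adj? u v) * 𝟙 (W? w ×-dec adj? v w)        ≡⟨ 𝟙-× (adj? u v) (W? w ×-dec adj? v w) ⟨
        𝟙 (adj? u v ×-dec (W? w ×-dec adj? v w))
          ≤⟨ 𝟙-mono (adj? u v ×-dec (W? w ×-dec adj? v w)) (W? w ×-dec (adj? u v ×-dec adj? w v))
                                                           (λ (uv , ww , vw) → ww , uv , adj-sym vw) ⟩
        𝟙 (W? w ×-dec (adj? u v ×-dec adj? w v))      ≡⟨ 𝟙-× (W? w) (adj? u v ×-dec adj? w v) ⟩
        𝟙 (W? w) * 𝟙 (adj? u v ×-dec adj? w v)        ∎

    -- Each vertex v is u, a neighbour of u, or in W.
    degree-split : ∀ v → deg v ≤ 𝟙 (u ≟ v) * deg u + (𝟙 (adj? u v) + 𝟙 (adj? u v) * degW v) + 𝟙 (W? v) * deg v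
    degree-split v with u ≟ v | v ≟ u | adj? u v
    ... | yes refl | _       | _      = ≤-trans (m≤m+n (deg u) 0) (≤-trans (m≤m+n _ _) (m≤m+n _ _))
    ... | no u≢v   | yes v≡u | _      = ⊥-elim (u≢v (sym v≡u))
    ... | no _     | no _    | yes uv =
      ≤-trans (neighbour-degree uv) (≤-reflexive (sym (trans (+-identityʳ _) (cong suc (+-identityʳ _)))))
    ... | no _     | no _    | no _   = ≤-reflexive (sym (+-identityʳ (deg v)))

    -- The degree sum, seen from u: the neighbours of u contribute deg u plus
    -- their edges into W, which are counted by the co-degrees in Φ.
    degree-sum : ∑[ v < N ] deg v ≤ deg u + deg u + Φ
    degree-sum = begin
      ∑[ v < N ] deg v                        ≤⟨ ∑-mono degree-split ⟩
      ∑[ v < N ] (a v + (b v + c v) + d v)    ≡⟨ split-sum ⟩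
      ∑[ v < N ] a v + (deg u + ∑[ v < N ] c v) + ∑[ v < N ] d v
        ≡⟨ cong (λ s → s + (deg u + ∑[ v < N ] c v) + ∑[ v < N ] d v) (∑-select (λ _ → deg u) u) ⟩
      deg u + (deg u + ∑[ v < N ] c v) + ∑[ v < N ] d v
        ≤⟨ +-monoˡ-≤ (∑[ v < N ] d v) (+-monoʳ-≤ (deg u) (+-monoʳ-≤ (deg u) neighbour-degree-sum)) ⟩
      deg u + (deg u + ∑[ w < N ] (𝟙 (W? w) * codeg u w)) + ∑[ v < N ] d v
        ≡⟨ trans (+-assoc (deg u) _ _) (cong (deg u +_) (+-assoc (deg u) _ _)) ⟩
      deg u + (deg u + (∑[ w < N ] (𝟙 (W? w) * codeg u w) + ∑[ v < N ] d v))
        ≡⟨ cong (λ s → deg u + (deg u + s)) merge-weights ⟩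
      deg u + (deg u + Φ)                     ≡⟨ +-assoc (deg u) _ _ ⟨
      deg u + deg u + Φ                       ∎
      where
      open ≤-Reasoning
      a b c d : Fin N → ℕ
      a v = 𝟙 (u ≟ v) * deg u
      b v = 𝟙 (adj? u v)
      c v = 𝟙 (adj? u v) * degW v
      d v = 𝟙 (W? v) * deg v
      split-sum : ∑[ v < N ] (a v + (b v + c v) + d v) ≡ ∑[ v < N ] a v + (deg u + ∑[ v < N ] c v) + ∑[ v < N ] d v
      split-sum = trans (∑-distrib-+ (λ v → a v + (b v + c v)) d)
                        (cong (_+ ∑[ v < N ] d v) (trans (∑-distrib-+ a (λ v → b v + c v))
                                                          (cong (∑[ v < N ] a v +_) (∑-distrib-+ b c))))
      merge-weights : ∑[ w < N ] (𝟙 (W? w) * codeg u w) + ∑[ v < N ] d v ≡ Φ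
      merge-weights = sym (trans (sum-cong-≗ (λ w → *-distribˡ-+ (𝟙 (W? w)) (codeg u w) (deg w)))
                                 (∑-distrib-+ (λ w → 𝟙 (W? w) * codeg u w) d))

    module Listed {k} (E : Enumeration W k) where
      open Enumeration E renaming (elem to w)

      Φ-listed : Φ ≤ ∑[ i < k ] weight (w i)
      Φ-listed = ∑-cover W? weight w elem-complete

      weight-listed : ∀ i → weight (w i) ≤ codeg u (w i) + (codeg u (w i) + ∑[ j < k ] 𝟙 (adj? (w i) (w j)))
      weight-listed i = +-monoʳ-≤ (codeg u (w i)) (begin
        deg (w i)                                     ≤⟨ nonneighbour-degree (elem-sound i) ⟩
        codeg u (w i) + degW (w i)
          ≡⟨ cong (codeg u (w i) +_) (sum-cong-≗ (λ x → 𝟙-× (W? x) (adj? (w i) x))) ⟩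
        codeg u (w i) + ∑[ x < N ] (𝟙 (W? x) * 𝟙 (adj? (w i) x))
          ≤⟨ +-monoʳ-≤ (codeg u (w i)) (∑-cover W? (λ x → 𝟙 (adj? (w i) x)) w elem-complete) ⟩
        codeg u (w i) + ∑[ j < k ] 𝟙 (adj? (w i) (w j)) ∎)
        where open ≤-Reasoning

      codeg-listed : ∀ i → codeg u (w i) ≤ 3
      codeg-listed i = codeg≤3 (λ u≡wi → proj₁ (elem-sound i) (sym u≡wi))

      self-loop : ∀ i → 𝟙 (adj? (w i) (w i)) ≡ 0
      self-loop i = 𝟙-no (adj? (w i) (w i)) adj-irrefl

    -- If W = {w}, then w has no neighbour in W and its weight is at most 3 + 3.
    Φ-one : Enumeration W 1 → Φ ≤ 6
    Φ-one E = begin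
      Φ                                  ≤⟨ Φ-listed ⟩
      weight (w zero) + 0                ≤⟨ +-monoˡ-≤ 0 (weight-listed zero) ⟩
      c + (c + (𝟙 (adj? (w zero) (w zero)) + 0)) + 0  ≡⟨ cong (λ l → c + (c + (l + 0)) + 0) (self-loop zero) ⟩
      c + (c + 0) + 0                    ≤⟨ +-monoˡ-≤ 0 (+-mono-≤ (codeg-listed zero) (+-monoˡ-≤ 0 (codeg-listed zero))) ⟩
      6                                  ∎
      where
      open ≤-Reasoning
      open Listed E
      open Enumeration E renaming (elem to w)
      c = codeg u (w zero)

    -- Two non-neighbours: if they are adjacent their common neighbourhoods
    -- with u are disjoint, which compensates for the edge between them.
    Φ-two : Enumeration W 2 → deg u ≤ 5 → Φ ≤ 12
    Φ-two E d≤5 =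
      ≤-trans Φ-listed (≤-trans (+-mono-≤ weight₀ (+-monoˡ-≤ 0 weight₁)) (pair (adj? w₀ w₁)))
      where
      open Listed E
      open Enumeration E renaming (elem to w)
      w₀ w₁ : Fin N
      w₀ = w zero
      w₁ = w (suc zero)
      c₀ c₁ e : ℕ
      c₀ = codeg u w₀
      c₁ = codeg u w₁
      e = 𝟙 (adj? w₀ w₁)
      weight₀ : weight w₀ ≤ c₀ + (c₀ + e)
      weight₀ = ≤-trans (weight-listed zero)
        (≤-reflexive (cong (λ t → c₀ + (c₀ + t)) (cong₂ _+_ (self-loop zero) (+-identityʳ e))))
      weight₁ : weight w₁ ≤ c₁ + (c₁ + e)
      weight₁ = ≤-trans (weight-listed (suc zero))
        (≤-reflexive (cong (λ t → c₁ + (c₁ + t))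
          (trans (cong₂ _+_ (𝟙-cong (adj? w₁ w₀) (adj? w₀ w₁) adj-sym adj-sym) (cong (_+ 0) (self-loop (suc zero))))
                 (+-identityʳ e))))
      pair : (a : Dec (Adj w₀ w₁)) → c₀ + (c₀ + 𝟙 a) + (c₁ + (c₁ + 𝟙 a) + 0) ≤ 12
      pair (yes a) = begin
        c₀ + (c₀ + 1) + (c₁ + (c₁ + 1) + 0)  ≡⟨ regroup c₀ c₁ ⟩
        (c₀ + c₁) + (c₀ + c₁) + 2            ≤⟨ +-monoˡ-≤ 2 (+-mono-≤ c₀+c₁≤5 c₀+c₁≤5) ⟩
        12                                   ∎
        where
        open ≤-Reasoning
        c₀+c₁≤5 : c₀ + c₁ ≤ 5
        c₀+c₁≤5 = ≤-trans (codeg-adjacent u a) d≤5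
        regroup : ∀ x y → x + (x + 1) + (y + (y + 1) + 0) ≡ (x + y) + (x + y) + 2
        regroup = solve-∀
      pair (no _) = +-mono-≤ (+-mono-≤ (codeg-listed zero) (+-monoˡ-≤ 0 (codeg-listed zero)))
                             (+-monoˡ-≤ 0 (+-mono-≤ (codeg-listed (suc zero)) (+-monoˡ-≤ 0 (codeg-listed (suc zero)))))

module _ (G : TriangleK24FreeGraph 7) where
  open GraphDegrees G

  -- Around a vertex u of degree at least 4 the set W has 6 - deg u ≤ 2
  -- elements; the three possible sizes are estimated separately.
  high-degree-bound : ∀ u → 4 ≤ deg u → ∑[ v < 7 ] deg v ≤ 21
  high-degree-bound u 4≤d = by-size (count W?) (enumerate W?) (m+n≤o⇒m≤o∸n (deg u) (≤-pred partition))
    where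
    open Around u
    estimate : ∀ {a b} → deg u ≤ a → Φ ≤ b → ∑[ v < 7 ] deg v ≤ a + a + b
    estimate d≤a Φ≤b = ≤-trans degree-sum (+-mono-≤ (+-mono-≤ d≤a d≤a) Φ≤b)
    by-size : ∀ k → Enumeration W k → deg u ≤ 6 ∸ k → ∑[ v < 7 ] deg v ≤ 21
    by-size 0 E d≤6 = ≤-trans (estimate d≤6 (Listed.Φ-listed E)) (m≤m+n 12 9)
    by-size 1 E d≤5 = ≤-trans (estimate d≤5 (Φ-one E)) (m≤m+n 16 5)
    by-size 2 E d≤4 = ≤-trans (estimate d≤4 (Φ-two E (≤-trans d≤4 (n≤1+n 4)))) (n≤1+n 20)
    by-size (suc (suc (suc k))) _ d≤3∸k = ⊥-elim (1+n≰n (≤-trans 4≤d (≤-trans d≤3∸k (m∸n≤m 3 k))))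

  degree-sum≤21 : ∑[ v < 7 ] deg v ≤ 21
  degree-sum≤21 with all? (λ v → deg v ≤? 3)
  ... | yes all≤3 = ∑-bounded deg 3 all≤3
  ... | no ¬all≤3 with ¬∀⟶∃¬ 7 (λ v → deg v ≤ 3) (λ v → deg v ≤? 3) ¬all≤3
  ...   | u , d≰3 = high-degree-bound u (≰⇒> d≰3)

-- Counting the union of e edges S 0, …, S (e-1) of an r-partite hypergraph:
-- each edge has r vertices, and a vertex of S j is lost for the union only if
-- it reappears in a later edge.
module EdgeUnion {r n m} (H : PartiteHypergraph r n m) where

  InUnion : ∀ {e} → (Fin e → Fin m) → Fin n → Set
  InUnion S x = ∃ λ j → ∃ λ i → edge H (S j) i ≡ x

  inUnion? : ∀ {e} (S : Fin e → Fin m) x → Dec (InUnion S x)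
  inUnion? S x = any? (λ j → any? (λ i → edge H (S j) i ≟ x))

  ∣edgeUnion∣ : ∀ {e} (S : Fin e → Fin m) → ∣ edgeUnion H S ∣ ≡ count (inUnion? S)
  ∣edgeUnion∣ S = ∣tabulate∣ (inUnion? S)

  Repeated : ∀ {e} → (Fin e → Fin m) → Fin e → Fin r → Set
  Repeated S j p = ∃ λ j' → j Fin.< j' × edge H (S j') p ≡ edge H (S j) p

  repeated? : ∀ {e} (S : Fin e → Fin m) j p → Dec (Repeated S j p)
  repeated? S j p = any? (λ j' → (j FinP.<? j') ×-dec (edge H (S j') p ≟ edge H (S j) p))

  repeats : ∀ {e} → (Fin e → Fin m) → Fin e → ℕ
  repeats S j = count (repeated? S j)

  shared-part : ∀ {a b i p} → edge H a i ≡ edge H b p → i ≡ p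
  shared-part {a} {b} {i} {p} e = trans (sym (edge-part H a i)) (trans (cong (part H) e) (edge-part H b p))

  module FirstEdge {e} (S : Fin (suc e) → Fin m) where
    S' : Fin e → Fin m
    S' j = S (suc j)

    g : Fin r → Fin n
    g = edge H (S zero)

    fresh : ℕ
    fresh = count (λ p → ¬? (inUnion? S' (g p)))

    New : Fin n → Set
    New x = (∃ λ i → g i ≡ x) × ¬ InUnion S' x

    new? : ∀ x → Dec (New x)
    new? x = any? (λ i → g i ≟ x) ×-dec ¬? (inUnion? S' x)

    -- Each vertex of the first edge is fresh or repeated later.
    first-edge : r ≤ fresh + repeats S zero
    first-edge = begin
      r                                                                   ≡⟨ trans (∑-const r 1) (*-identityʳ r) ⟨
      ∑[ p < r ] 1                                                        ≤⟨ ∑-mono fresh-or-repeated ⟩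
      ∑[ p < r ] (𝟙 (¬? (inUnion? S' (g p))) + 𝟙 (repeated? S zero p))
        ≡⟨ ∑-distrib-+ (λ p → 𝟙 (¬? (inUnion? S' (g p)))) (λ p → 𝟙 (repeated? S zero p)) ⟩
      fresh + repeats S zero                                              ∎
      where
      open ≤-Reasoning
      fresh-or-repeated : ∀ p → 1 ≤ 𝟙 (¬? (inUnion? S' (g p))) + 𝟙 (repeated? S zero p)
      fresh-or-repeated p with inUnion? S' (g p)
      ... | no _ = s≤s z≤n
      ... | yes (j , i , e) = ≤-reflexive (sym (𝟙-yes (repeated? S zero p)
                                (suc j , s≤s z≤n , subst (λ i → edge H (S' j) i ≡ g p) (shared-part e) e)))

    fresh≤new : fresh ≤ count new?
    fresh≤new = count-injection (λ p → ¬? (inUnion? S' (g p))) new? (λ p x → (g p ≟ x) ×-dec ¬? (inUnion? S' x))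
      (λ p fresh-p → g p , refl , fresh-p) (λ p x (gp≡x , ¬u) → (p , gp≡x) , ¬u)
      (λ p p' x (gp≡x , _) (gp'≡x , _) → shared-part (trans gp≡x (sym gp'≡x)))

    union-grows : count (inUnion? S') + count new? ≤ count (inUnion? S)
    union-grows = ≤-trans (≤-reflexive (sym (∑-distrib-+ (λ x → 𝟙 (inUnion? S' x)) (λ x → 𝟙 (new? x)))))
      (∑-mono (λ x → 𝟙-disjoint (inUnion? S' x) (new? x) (inUnion? S x)
                       (λ (j , i , e) → suc j , i , e) (λ ((i , e) , _) → zero , i , e) (λ u (_ , ¬u) → ¬u u)))

    later-repeats : ∑[ j < e ] repeats S' j ≤ ∑[ j < e ] repeats S (suc j)
    later-repeats = ∑-mono (λ j → ∑-mono (λ p → 𝟙-mono (repeated? S' j p) (repeated? S (suc j) p)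
                      (λ (j' , j<j' , same) → suc j' , s≤s j<j' , same)))

  union-bound : ∀ {e} (S : Fin e → Fin m) → e * r ≤ count (inUnion? S) + ∑[ j < e ] repeats S j
  union-bound {zero} S = z≤n
  union-bound {suc e} S = begin
    r + e * r                          ≤⟨ +-mono-≤ first-edge (union-bound S') ⟩
    (fresh + repeats S zero) + (count (inUnion? S') + ∑[ j < e ] repeats S' j)
      ≡⟨ regroup fresh (repeats S zero) (count (inUnion? S')) (∑[ j < e ] repeats S' j) ⟩
    (count (inUnion? S') + fresh) + (repeats S zero + ∑[ j < e ] repeats S' j)
      ≤⟨ +-mono-≤ (+-monoʳ-≤ (count (inUnion? S')) fresh≤new) (+-monoʳ-≤ (repeats S zero) later-repeats) ⟩
    (count (inUnion? S') + count new?) + ∑[ j < suc e ] repeats S j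
      ≤⟨ +-monoˡ-≤ _ union-grows ⟩
    count (inUnion? S) + ∑[ j < suc e ] repeats S j ∎
    where
    open ≤-Reasoning
    open FirstEdge S
    regroup : ∀ a b c d → (a + b) + (c + d) ≡ (c + a) + (b + d)
    regroup = solve-∀

injective₃ : ∀ {A : Set} {a b c : A} → a ≢ b → a ≢ c → b ≢ c → Injective _≡_ _≡_ (lookup (a ∷ b ∷ c ∷ []))
injective₃ ab ac bc = lookup-injective ((ab ∷ ac ∷ []) ∷ (bc ∷ []) ∷ [] ∷ []) _ _

injective₄ : ∀ {A : Set} {a b c d : A} → a ≢ b → a ≢ c → a ≢ d → b ≢ c → b ≢ d → c ≢ d →
             Injective _≡_ _≡_ (lookup (a ∷ b ∷ c ∷ d ∷ []))
injective₄ ab ac ad bc bd cd = lookup-injective ((ab ∷ ac ∷ ad ∷ []) ∷ (bc ∷ bd ∷ []) ∷ (cd ∷ []) ∷ [] ∷ []) _ _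

module SevenEdges {r n m} (H : PartiteHypergraph r n m) (linear : Linear H)
  (no-C3 : ¬ RainbowCycle H 3) (no-C4 : ¬ RainbowCycle H 4)
  (S : Fin 7 → Fin m) (S-injective : Injective _≡_ _≡_ S) where
  open EdgeUnion H using (shared-part; Repeated; repeated?; repeats)

  val : Fin r → Fin 7 → Fin n
  val p x = edge H (S x) p

  Meet : Fin 7 → Fin 7 → Fin r → Set
  Meet x y p = val p x ≡ val p y

  S-distinct : ∀ {x y} → x ≢ y → S x ≢ S y
  S-distinct x≢y e = x≢y (S-injective e)

  meet-unique : ∀ {x y p q} → x ≢ y → Meet x y p → Meet x y q → p ≡ q
  meet-unique {x} {y} {p} {q} x≢y xyp xyq =
    shared-part (linear (S x) (S y) (val p x) (val q x) (S-distinct x≢y) (p , refl) (p , sym xyp) (q , refl) (q , sym xyq))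

  rainbow-cycle : ∀ {k} (B : Fin (suc k) → Fin 7) (q : Fin (suc k) → Fin r) →
    Injective _≡_ _≡_ B → Injective _≡_ _≡_ q → (∀ i → Meet (B i) (B (next i)) (q (next i))) →
    RainbowCycle H (suc k)
  rainbow-cycle B q B-injective q-injective meets =
    v , (λ i → S (B i)) , (λ e → parts-injective (cong (part H) e)) , (λ e → B-injective (S-injective e)) ,
    parts-injective , (λ i → q i , refl) , (λ i → q (next i) , meets i)
    where
    v : _ → Fin n
    v i = val (q i) (B i)
    parts-injective : Injective _≡_ _≡_ (λ i → part H (v i))
    parts-injective {i} {j} e =
      q-injective (trans (sym (edge-part H (S (B i)) (q i))) (trans e (edge-part H (S (B j)) (q j))))

  triangle-one-part : ∀ {a b c p q s} → a ≢ b → b ≢ c → a ≢ c →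
                      Meet a b p → Meet b c q → Meet c a s → p ≡ q
  triangle-one-part {a} {b} {c} {p} {q} {s} a≢b b≢c a≢c ab bc ca with p ≟ q | s ≟ p | s ≟ q
  ... | yes p≡q | _ | _ = p≡q
  ... | no p≢q | yes refl | _ = ⊥-elim (p≢q (meet-unique b≢c (trans (sym ab) (sym ca)) bc))
  ... | no p≢q | no _ | yes refl = ⊥-elim (p≢q (meet-unique a≢b ab (trans (sym ca) (sym bc))))
  ... | no p≢q | no s≢p | no s≢q =
    ⊥-elim (no-C3 (rainbow-cycle (lookup (a ∷ b ∷ c ∷ [])) (lookup (s ∷ p ∷ q ∷ []))
                    (injective₃ a≢b a≢c b≢c) (injective₃ s≢p s≢q p≢q) meets))
    where
    meets : ∀ i → _
    meets zero = ab
    meets (suc zero) = bc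
    meets (suc (suc zero)) = ca

  no-rainbow-square : ∀ {a b c d p₁ p₂ p₃ p₄} → a ≢ b → a ≢ c → a ≢ d → b ≢ c → b ≢ d → c ≢ d →
    Meet a b p₁ → Meet b c p₂ → Meet c d p₃ → Meet d a p₄ →
    p₄ ≢ p₁ → p₄ ≢ p₂ → p₄ ≢ p₃ → p₁ ≢ p₂ → p₁ ≢ p₃ → p₂ ≢ p₃ → ⊥
  no-rainbow-square {a} {b} {c} {d} {p₁} {p₂} {p₃} {p₄} ab ac ad bc bd cd m₁ m₂ m₃ m₄ p₄₁ p₄₂ p₄₃ p₁₂ p₁₃ p₂₃ =
    no-C4 (rainbow-cycle (lookup (a ∷ b ∷ c ∷ d ∷ [])) (lookup (p₄ ∷ p₁ ∷ p₂ ∷ p₃ ∷ []))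
             (injective₄ ab ac ad bc bd cd) (injective₄ p₄₁ p₄₂ p₄₃ p₁₂ p₁₃ p₂₃) meets)
    where
    meets : ∀ i → _
    meets zero = m₁
    meets (suc zero) = m₂
    meets (suc (suc zero)) = m₃
    meets (suc (suc (suc zero))) = m₄

  -- The merge graph on the seven edges: x → y is an arc when y (after x) is
  -- the last edge through the vertex of x in some part p.
  LastMeet : Fin 7 → Fin r → Fin 7 → Set
  LastMeet x p y = x Fin.< y × Meet x y p × (∀ z → Meet x z p → z Fin.≤ y)

  lastMeet? : ∀ x p y → Dec (LastMeet x p y)
  lastMeet? x p y = (x FinP.<? y) ×-dec ((val p x ≟ val p y) ×-dec all? (λ z → (val p x ≟ val p z) →-dec (z FinP.≤? y)))

  Arc : Fin 7 → Fin 7 → Set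
  Arc x y = Σ (Fin r) λ p → LastMeet x p y

  arc? : ∀ x y → Dec (Arc x y)
  arc? x y = any? (λ p → lastMeet? x p y)

  Adjacent : Fin 7 → Fin 7 → Set
  Adjacent x y = Arc x y ⊎ Arc y x

  adjacent? : ∀ x y → Dec (Adjacent x y)
  adjacent? x y = arc? x y ⊎-dec arc? y x

  -- An adjacency in part p, stated symmetrically: x and y meet in part p and
  -- the last edge through their common vertex is x or y.
  record Link (x y : Fin 7) (p : Fin r) : Set where
    field
      meets : Meet x y p
      last : Fin 7
      last-end : last ≡ x ⊎ last ≡ y
      last-max : ∀ z → Meet x z p → z Fin.≤ last
  open Link

  link : ∀ {x y} → Adjacent x y → Σ (Fin r) (Link x y)
  link (inj₁ (p , _ , xy , max)) = p , record { meets = xy ; last = _ ; last-end = inj₂ refl ; last-max = max }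
  link (inj₂ (p , _ , yx , max)) =
    p , record { meets = sym yx ; last = _ ; last-end = inj₁ refl ; last-max = λ z xz → max z (trans yx xz) }

  link-sym : ∀ {x y p} → Link x y p → Link y x p
  link-sym l = record { meets = sym (meets l) ; last = last l ; last-end = swap (last-end l)
                      ; last-max = λ z yz → last-max l z (trans (meets l) yz) }
    where
    swap : ∀ {a b c : Fin 7} → a ≡ b ⊎ a ≡ c → a ≡ c ⊎ a ≡ b
    swap (inj₁ e) = inj₂ e
    swap (inj₂ e) = inj₁ e

  last-meets : ∀ {x y p} (l : Link x y p) → Meet (last l) x p
  last-meets l with last-end l
  ... | inj₁ refl = refl
  ... | inj₂ refl = sym (meets l)

  same-last : ∀ {x y z w p} (l₁ : Link x y p) (l₂ : Link z w p) → Meet z x p → last l₁ ≡ last l₂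
  same-last l₁ l₂ zx = FinP.≤-antisym (last-max l₂ _ (trans zx (sym (last-meets l₁))))
                                     (last-max l₁ _ (trans (sym zx) (sym (last-meets l₂))))

  adjacent-irrefl : ∀ {x} → ¬ Adjacent x x
  adjacent-irrefl (inj₁ (_ , x<x , _)) = FinP.<-irrefl refl x<x
  adjacent-irrefl (inj₂ (_ , x<x , _)) = FinP.<-irrefl refl x<x

  adjacent-distinct : ∀ {x y} → Adjacent x y → x ≢ y
  adjacent-distinct xy refl = adjacent-irrefl xy

  adjacent-sym : ∀ {x y} → Adjacent x y → Adjacent y x
  adjacent-sym (inj₁ a) = inj₂ a
  adjacent-sym (inj₂ a) = inj₁ a

  disjoint-ends : ∀ {M a b c d : Fin 7} → M ≡ a ⊎ M ≡ b → M ≡ c ⊎ M ≡ d →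
                  a ≢ c → a ≢ d → b ≢ c → b ≢ d → ⊥
  disjoint-ends (inj₁ refl) (inj₁ e) ac _ _ _ = ac e
  disjoint-ends (inj₁ refl) (inj₂ e) _ ad _ _ = ad e
  disjoint-ends (inj₂ refl) (inj₁ e) _ _ bc _ = bc e
  disjoint-ends (inj₂ refl) (inj₂ e) _ _ _ bd = bd e

  -- A triangle would use one part (no rainbow triangle), so its three links
  -- pass through one vertex and share a last edge, which is impossible.
  merge-triangle-free : ∀ {a b c} → Adjacent a b → Adjacent b c → Adjacent a c → ⊥
  merge-triangle-free {a} {b} {c} ab bc ac with link ab | link bc | link ac
  ... | p , l₁ | q , l₂ | s , l₃
    with triangle-one-part a≢b b≢c a≢c (meets l₁) (meets l₂) (sym (meets l₃))
       | triangle-one-part b≢c (≢-sym a≢c) (≢-sym a≢b) (meets l₂) (sym (meets l₃)) (meets l₁)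
    where a≢b = adjacent-distinct ab
          b≢c = adjacent-distinct bc
          a≢c = adjacent-distinct ac
  ...   | refl | refl = three-ends (last-end l₁) (subst (λ M → M ≡ b ⊎ M ≡ c) (sym last₁₂) (last-end l₂))
                                                 (subst (λ M → M ≡ a ⊎ M ≡ c) (sym last₁₃) (last-end l₃))
    where
    last₁₂ = same-last l₁ l₂ (sym (meets l₁))
    last₁₃ = same-last l₁ l₃ refl
    three-ends : ∀ {M} → M ≡ a ⊎ M ≡ b → M ≡ b ⊎ M ≡ c → M ≡ a ⊎ M ≡ c → ⊥
    three-ends (inj₁ refl) (inj₁ e) _ = adjacent-distinct ab e
    three-ends (inj₁ refl) (inj₂ e) _ = adjacent-distinct ac e
    three-ends (inj₂ refl) _ (inj₁ e) = adjacent-distinct ab (sym e)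
    three-ends (inj₂ refl) _ (inj₂ e) = adjacent-distinct bc e

  -- In a 4-cycle y₀ y₁ y₂ y₃ two consecutive links cannot use the same part:
  -- y₀, y₂, y₃ would meet in that part, giving the links y₀y₁ and y₂y₃ a
  -- common last edge.
  consecutive-parts : ∀ {y₀ y₁ y₂ y₃ p q s} → y₀ ≢ y₂ → y₂ ≢ y₃ → y₀ ≢ y₃ → y₁ ≢ y₂ → y₁ ≢ y₃ →
                      Link y₀ y₁ p → Link y₁ y₂ p → Link y₂ y₃ q → Meet y₃ y₀ s → ⊥
  consecutive-parts y₀≢y₂ y₂≢y₃ y₀≢y₃ y₁≢y₂ y₁≢y₃ l₀₁ l₁₂ l₂₃ m₃₀
    with triangle-one-part y₀≢y₂ y₂≢y₃ y₀≢y₃ (trans (meets l₀₁) (meets l₁₂)) (meets l₂₃) m₃₀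
  ... | refl = disjoint-ends (last-end l₀₁)
                 (subst (λ M → M ≡ _ ⊎ M ≡ _) (sym (same-last l₀₁ l₂₃ (sym (trans (meets l₀₁) (meets l₁₂))))) (last-end l₂₃))
                 y₀≢y₂ y₀≢y₃ y₁≢y₂ y₁≢y₃

  -- In a 4-cycle of the merge graph consecutive parts differ, hence (no
  -- rainbow quadrilateral) one pair of opposite links uses the same part.
  square-parts : ∀ {y₀ y₁ y₂ y₃ p₀₁ p₁₂ p₂₃ p₃₀} →
    y₀ ≢ y₁ → y₀ ≢ y₂ → y₀ ≢ y₃ → y₁ ≢ y₂ → y₁ ≢ y₃ → y₂ ≢ y₃ →
    Link y₀ y₁ p₀₁ → Link y₁ y₂ p₁₂ → Link y₂ y₃ p₂₃ → Link y₃ y₀ p₃₀ →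
    (p₀₁ ≡ p₂₃ ⊎ p₁₂ ≡ p₃₀) × p₁₂ ≢ p₂₃ × p₃₀ ≢ p₀₁
  square-parts {p₀₁ = p₀₁} {p₁₂ = p₁₂} {p₂₃ = p₂₃} {p₃₀ = p₃₀} n₀₁ n₀₂ n₀₃ n₁₂ n₁₃ n₂₃ l₀₁ l₁₂ l₂₃ l₃₀ =
    opposite , d₁₂ , d₃₀
    where
    d₀₁ : p₀₁ ≢ p₁₂
    d₀₁ refl = consecutive-parts n₀₂ n₂₃ n₀₃ n₁₂ n₁₃ l₀₁ l₁₂ l₂₃ (meets l₃₀)
    d₁₂ : p₁₂ ≢ p₂₃
    d₁₂ refl = consecutive-parts n₁₃ (≢-sym n₀₃) (≢-sym n₀₁) n₂₃ (≢-sym n₀₂) l₁₂ l₂₃ l₃₀ (meets l₀₁)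
    d₂₃ : p₂₃ ≢ p₃₀
    d₂₃ refl = consecutive-parts (≢-sym n₀₂) n₀₁ (≢-sym n₁₂) (≢-sym n₀₃) (≢-sym n₁₃) l₂₃ l₃₀ l₀₁ (meets l₁₂)
    d₃₀ : p₃₀ ≢ p₀₁
    d₃₀ refl = consecutive-parts (≢-sym n₁₃) n₁₂ (≢-sym n₂₃) n₀₁ n₀₂ l₃₀ l₀₁ l₁₂ (meets l₂₃)
    opposite : p₀₁ ≡ p₂₃ ⊎ p₁₂ ≡ p₃₀
    opposite with p₀₁ ≟ p₂₃ | p₁₂ ≟ p₃₀
    ... | yes e | _ = inj₁ e
    ... | no _ | yes e = inj₂ e
    ... | no ¬e₁ | no ¬e₂ = ⊥-elim (no-rainbow-square n₀₁ n₀₂ n₀₃ n₁₂ n₁₃ n₂₃ (meets l₀₁) (meets l₁₂) (meets l₂₃) (meets l₃₀)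
                                      d₃₀ (≢-sym ¬e₂) (≢-sym d₂₃) d₀₁ ¬e₁ d₁₂)

  -- For a K₂,₄ with sides {u, w} and {f 0, …, f 3}, write a i and b i for the
  -- parts of the links u–f i and w–f i.  Each 4-cycle u, f 0, w, f j forces
  -- a 0 ≡ b j or b 0 ≡ a j; two of the three j agree on the alternative,
  -- contradicting that the b's (resp. a's) in a 4-cycle differ.
  merge-K24-free : ∀ {u w} (f : Fin 4 → Fin 7) → u ≢ w → Injective _≡_ _≡_ f →
                   (∀ i → Adjacent u (f i)) → (∀ i → Adjacent w (f i)) → ⊥
  merge-K24-free f u≢w f-injective uf wf =
    pigeonhole (square 0F 1F (λ ())) (square 0F 2F (λ ())) (square 0F 3F (λ ()))
    where
    a b : Fin 4 → Fin r
    a i = proj₁ (link (uf i))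
    b i = proj₁ (link (wf i))
    square : ∀ i j → i ≢ j → (a i ≡ b j ⊎ b i ≡ a j) × b i ≢ b j × a j ≢ a i
    square i j i≢j =
      square-parts (adjacent-distinct (uf i)) u≢w (adjacent-distinct (uf j)) (≢-sym (adjacent-distinct (wf i)))
                   (λ e → i≢j (f-injective e)) (adjacent-distinct (wf j))
                   (proj₂ (link (uf i))) (link-sym (proj₂ (link (wf i)))) (proj₂ (link (wf j))) (link-sym (proj₂ (link (uf j))))
    b-distinct : ∀ i j → i ≢ j → b i ≢ b j
    b-distinct i j i≢j = proj₁ (proj₂ (square i j i≢j))
    a-distinct : ∀ i j → i ≢ j → a j ≢ a i
    a-distinct i j i≢j = proj₂ (proj₂ (square i j i≢j))
    pigeonhole : ∀ {X Y Z} → (a 0F ≡ b 1F ⊎ b 0F ≡ a 1F) × X → (a 0F ≡ b 2F ⊎ b 0F ≡ a 2F) × Y →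
                 (a 0F ≡ b 3F ⊎ b 0F ≡ a 3F) × Z → ⊥
    pigeonhole (inj₁ e₁ , _) (inj₁ e₂ , _) _ = b-distinct 1F 2F (λ ()) (trans (sym e₁) e₂)
    pigeonhole (inj₁ e₁ , _) (inj₂ _ , _) (inj₁ e₃ , _) = b-distinct 1F 3F (λ ()) (trans (sym e₁) e₃)
    pigeonhole (inj₁ _ , _) (inj₂ e₂ , _) (inj₂ e₃ , _) = a-distinct 2F 3F (λ ()) (trans (sym e₃) e₂)
    pigeonhole (inj₂ _ , _) (inj₁ e₂ , _) (inj₁ e₃ , _) = b-distinct 2F 3F (λ ()) (trans (sym e₂) e₃)
    pigeonhole (inj₂ e₁ , _) (inj₁ _ , _) (inj₂ e₃ , _) = a-distinct 1F 3F (λ ()) (trans (sym e₃) e₁)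
    pigeonhole (inj₂ e₁ , _) (inj₂ e₂ , _) _ = a-distinct 1F 2F (λ ()) (trans (sym e₂) e₁)

  mergeGraph : TriangleK24FreeGraph 7
  mergeGraph = record
    { Adj = Adjacent ; adj? = adjacent? ; adj-sym = adjacent-sym ; adj-irrefl = adjacent-irrefl
    ; triangle-free = merge-triangle-free ; K24-free = merge-K24-free }

  open GraphDegrees mergeGraph using (deg)

  -- A repeated vertex of S j in part p yields the arc from j to the last edge
  -- through it; distinct parts give distinct arcs by linearity.
  repeats≤arcs : ∀ j → repeats S j ≤ count (arc? j)
  repeats≤arcs j = count-injection (repeated? S j) (arc? j) (lastMeet? j) last-edge (λ p y lm → p , lm) one-part
    where
    last-edge : ∀ p → Repeated S j p → ∃ λ y → LastMeet j p y
    last-edge p (j' , j<j' , same) with largest (λ z → val p j ≟ val p z) (j' , sym same)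
    ... | M , jM , max = M , <-≤-trans j<j' (max j' (sym same)) , jM , max
    one-part : ∀ p p' y → LastMeet j p y → LastMeet j p' y → p ≡ p'
    one-part p p' y (j<y , m , _) (_ , m' , _) = meet-unique (FinP.<⇒≢ j<y) m m'

  -- Every arc contributes to the degrees of both of its ends.
  arcs-twice : ∑[ x < 7 ] count (arc? x) + ∑[ x < 7 ] count (arc? x) ≤ ∑[ x < 7 ] deg x
  arcs-twice = begin
    ∑[ x < 7 ] count (arc? x) + ∑[ x < 7 ] count (arc? x)
      ≡⟨ cong (∑[ x < 7 ] count (arc? x) +_) (∑-comm (λ x y → 𝟙 (arc? x y))) ⟩
    ∑[ x < 7 ] count (arc? x) + ∑[ x < 7 ] ∑[ y < 7 ] 𝟙 (arc? y x)
      ≡⟨ ∑-distrib-+ (λ x → count (arc? x)) (λ x → ∑[ y < 7 ] 𝟙 (arc? y x)) ⟨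
    ∑[ x < 7 ] (∑[ y < 7 ] 𝟙 (arc? x y) + ∑[ y < 7 ] 𝟙 (arc? y x))
      ≡⟨ sum-cong-≗ (λ x → ∑-distrib-+ (λ y → 𝟙 (arc? x y)) (λ y → 𝟙 (arc? y x))) ⟨
    ∑[ x < 7 ] ∑[ y < 7 ] (𝟙 (arc? x y) + 𝟙 (arc? y x))
      ≤⟨ ∑-mono (λ x → ∑-mono (λ y → 𝟙-disjoint (arc? x y) (arc? y x) (adjacent? x y) inj₁ inj₂
                                         (λ (_ , x<y , _) (_ , y<x , _) → FinP.<-asym x<y y<x))) ⟩
    ∑[ x < 7 ] deg x ∎
    where open ≤-Reasoning

  repeats-bound : ∑[ j < 7 ] repeats S j ≤ 10
  repeats-bound = half (≤-trans (+-mono-≤ arcs arcs) (≤-trans arcs-twice (degree-sum≤21 mergeGraph)))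
    where
    arcs : ∑[ j < 7 ] repeats S j ≤ ∑[ x < 7 ] count (arc? x)
    arcs = ∑-mono repeats≤arcs
    half : ∀ {x} → x + x ≤ 21 → x ≤ 10
    half {x} x+x≤21 with x ≤? 10
    ... | yes x≤10 = x≤10
    ... | no x≰10 = ⊥-elim (1+n≰n (≤-trans (+-mono-≤ (≰⇒> x≰10) (≰⇒> x≰10)) x+x≤21))

theorem15 : (r n m : ℕ) → 3 ≤ r → (H : PartiteHypergraph r n m) →
    Linear H → ¬ RainbowCycle H 3 → ¬ RainbowCycle H 4 →
    GFree H (7 * r ∸ 11) 7
theorem15 r n m 3≤r H linear no-C3 no-C4 S S-injective = +-cancelʳ-≤ 10 _ _ (begin
  suc (7 * r ∸ 11) + 10                          ≡⟨ +-suc (7 * r ∸ 11) 10 ⟨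
  7 * r ∸ 11 + 11                                ≡⟨ m∸n+n≡m 11≤7r ⟩
  7 * r                                          ≤⟨ union-bound S ⟩
  count (inUnion? S) + ∑[ j < 7 ] repeats S j    ≤⟨ +-monoʳ-≤ (count (inUnion? S)) repeats-bound ⟩
  count (inUnion? S) + 10                        ≡⟨ cong (_+ 10) (∣edgeUnion∣ S) ⟨
  ∣ edgeUnion H S ∣ + 10                         ∎)
  where
  open ≤-Reasoning
  open EdgeUnion H
  open SevenEdges H linear no-C3 no-C4 S S-injective using (repeats-bound)
  11≤7r : 11 ≤ 7 * r
  11≤7r = ≤-trans (m≤m+n 11 10) (*-monoʳ-≤ 7 3≤r)
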